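{- Let $d\geqslant 2$ and let $n$ be a positive integer. If $d\geqslant 3$, then the maximum of $p_{A_d}(\boldsymbol{\lambda})$ over all $A_d$-partitions $\boldsymbol{\lambda}$ of $n$ is attained at the partition consisting of $\lfloor n/2^d\rfloor$ parts equal to $2^d$ and $n-2^d\lfloor n/2^d\rfloor$ parts equal to $1$. If $d=2$, this maximum is attained at the following partitions (parts with multiplicities written as exponents): $(4^{\lfloor n/4\rfloor},1^{n-4\lfloor n/4\rfloor})$ for all $n$; $(9,4^{\lfloor (n-9)/4\rfloor},1^{n-4\lfloor (n-9)/4\rfloor-9})$ if $n\equiv1,2,3\pmod 4$ and $n\geqslant 9$; $(9^2,4^{\lfloor (n-18)/4\rfloor},1^{n-4\lfloor (n-18)/4\rfloor-18})$ if $n\equiv 2,3\pmod 4$ and $n\geqslant 18$; $(9^3,4^{\lfloor (n-27)/4\rfloor},1^{n-4\lfloor (n-27)/4\rfloor-27})$ if $n\equiv 3\pmod 4$ and $n\geqslant 27$. In particular, for every $d\geqslant2$, $$\max\{p_{A_d}(\boldsymbol{\lambda}):\boldsymbol{\lambda}\text{ an } A_d\text{ -partition of } n\}=2^{\lfloor n/2^d\rfloor}.$$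
   Context: For an integer $d\geqslant2$, let $A_d=\{n^d:n\in\mathbb{N}_+\}$. An $A_d$-partition of $n$ is a partition of $n$ all of whose parts lie in $A_d$, and $p_{A_d}(n)$ is the number of such partitions. For an $A_d$-partition $\boldsymbol{\lambda}=(\lambda_1,\ldots,\lambda_j)$, the extended function is $p_{A_d}(\boldsymbol{\lambda})=\prod_{i=1}^j p_{A_d}(\lambda_i)$. The notation $(a^k,b^l,\ldots)$ means the partition with $k$ parts equal to $a$, $l$ parts equal to $b$, etc. -}

module Defs where

open import Data.Nat using (ℕ; zero; suc; _+_; _*_; _∸_; _^_; _≤_; _≤?_)
open import Data.Nat.Properties using (m^n≢0)
open import Data.Nat.DivMod using (_/_)
open import Data.List using (List; []; _∷_; map; upTo; replicate; _++_)
open import Data.Nat.ListAction using (sum; product)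
open import Data.List.Relation.Unary.All using (All)
open import Data.Product using (Σ; _×_)
open import Relation.Binary.PropositionalEquality using (_≡_)
open import Relation.Nullary.Decidable using (does)
open import Data.Bool using (if_then_else_)

InA : ℕ → ℕ → Set
InA d x = Σ ℕ (λ k → (1 ≤ k) × (x ≡ k ^ d))

-- An A_d-partition of n, represented as a list of parts (order irrelevant
-- for everything below): every part lies in A_d and the parts sum to n.
IsAPartition : ℕ → ℕ → List ℕ → Set
IsAPartition d n λs = All (InA d) λs × (sum λs ≡ n)

-- cnt d m k = number of partitions of m into parts from {1^d, 2^d, ..., k^d},
-- counted by the multiplicity j of the largest allowed part k^d.
cnt : ℕ → ℕ → ℕ → ℕ
cnt d zero    zero    = 1
cnt d (suc m) zero    = 0
cnt d m       (suc k) =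
  sum (map (λ j → if does (j * (suc k ^ d) ≤? m)
                    then cnt d (m ∸ j * (suc k ^ d)) k
                    else 0)
           (upTo (suc m)))

-- p_{A_d}(m): number of A_d-partitions of m (parts k^d with k ≤ m suffice).
pA : ℕ → ℕ → ℕ
pA d m = cnt d m m

pAList : ℕ → List ℕ → ℕ
pAList d λs = product (map (pA d) λs)

IsMaximizer : ℕ → ℕ → List ℕ → Set
IsMaximizer d n λs =
  IsAPartition d n λs × ((μ : List ℕ) → IsAPartition d n μ → pAList d μ ≤ pAList d λs)

_/2^_ : ℕ → ℕ → ℕ
n /2^ d = _/_ n (2 ^ d) {{m^n≢0 2 d}}

mainPartition : ℕ → ℕ → List ℕ
mainPartition d n = replicate (n /2^ d) (2 ^ d) ++ replicate (n ∸ 2 ^ d * (n /2^ d)) 1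

ninePartition : ℕ → ℕ → List ℕ
ninePartition r n =
  replicate r 9 ++ replicate ((n ∸ 9 * r) /2^ 2) 4
    ++ replicate (n ∸ 4 * ((n ∸ 9 * r) /2^ 2) ∸ 9 * r) 1

module Submission where

-- Write N m = ⌊m/2^d⌋ and c(m,k) for the number of partitions of m into parts 1^d, …, k^d,
-- so that c(m,k+1) = c(m,k) + c(m − (k+1)^d, k+1). For d ≥ 2 we have (b+1)·2^d ≤ (b+2)^d,
-- so removing a part (b+2)^d lowers N by at least b+1; induction on the largest part gives
-- c(m,b+1) ≤ 2^(N m) − 2^(N m − b) + 1, hence p_{A_d}(m) ≤ 2^(N m). As N is superadditive,
-- p_{A_d}(λ) ≤ 2^(N n) for every A_d-partition λ of n. The partition (2^d)^(N n) 1^… attains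
-- this since p_{A_d}(2^d) ≥ 2 and p_{A_d}(1) = 1. For d = 2, a part 9 may replace two parts 4
-- and a part 1 without changing the value, as p_{A_2}(9) = 4 = p_{A_2}(4)^2; doing this r times
-- keeps ⌊n/4⌋ − 2r parts 4 exactly when r ≤ n mod 4.

open import Defs
open import Data.Nat using (ℕ; zero; suc; _+_; _*_; _∸_; _^_; _≤_; _<_; _≤?_; _%_; _/_; z≤n; s≤s; NonZero; _≤′_; ≤′-refl; ≤′-step)
open import Data.Nat.Properties
open import Data.Nat.DivMod using (m/n*n≤m; m*n/n≡m; /-monoˡ-≤; [m∸n*o]/o≡m/o∸n; m≡m%n+[m/n]*n)
open import Data.Nat.Induction using (<-rec)
open import Data.Nat.ListAction using (sum; product)
open import Data.Nat.ListAction.Properties using (sum-++; product-++)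
open import Data.Nat.Tactic.RingSolver using (solve-∀)
open import Algebra.Properties.CommutativeSemigroup *-commutativeSemigroup using (x∙yz≈y∙xz)
open import Data.Bool using (if_then_else_)
open import Data.List using (List; []; _∷_; map; applyUpTo; replicate; _++_)
open import Data.List.Properties using (map-upTo; map-++; map-replicate)
open import Data.List.Relation.Unary.All.Properties using (++⁺; replicate⁺)
open import Data.Product using (Σ; _×_; _,_)
open import Data.Sum using (_⊎_; inj₁; inj₂)
open import Function using (_∘_)
open import Function.Bundles using (_⇔_; mk⇔)
open import Relation.Nullary.Decidable using (yes; no; does; does-⇔; dec-false)
open import Relation.Binary.PropositionalEquality

m*n≤o⇒m≤o/n : ∀ m n o .{{_ : NonZero n}} → m * n ≤ o → m ≤ o / n
m*n≤o⇒m≤o/n m n o m*n≤o = subst (_≤ o / n) (m*n/n≡m m n) (/-monoˡ-≤ n m*n≤o)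

/-superadditive : ∀ m n o .{{_ : NonZero o}} → m / o + n / o ≤ (m + n) / o
/-superadditive m n o = m*n≤o⇒m≤o/n (m / o + n / o) o (m + n) (begin
  (m / o + n / o) * o     ≡⟨ *-distribʳ-+ o (m / o) (n / o) ⟩
  m / o * o + n / o * o   ≤⟨ +-mono-≤ (m/n*n≤m m o) (m/n*n≤m n o) ⟩
  m + n                   ∎)
  where open ≤-Reasoning

[2+b]^2≡[1+b]*4+b*b : ∀ b → (2 + b) * ((2 + b) * 1) ≡ suc b * 4 + b * b
[2+b]^2≡[1+b]*4+b*b = solve-∀

[1+b]*2^d≤[2+b]^d : ∀ {d} → 2 ≤ d → ∀ b → suc b * 2 ^ d ≤ (2 + b) ^ d
[1+b]*2^d≤[2+b]^d (s≤s (s≤s {n = e} z≤n)) b = go e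
  where
  open ≤-Reasoning
  go : ∀ e → suc b * 2 ^ (2 + e) ≤ (2 + b) ^ (2 + e)
  go zero    = ≤-trans (m≤m+n (suc b * 4) (b * b)) (≤-reflexive (sym ([2+b]^2≡[1+b]*4+b*b b)))
  go (suc e) = begin
    suc b * (2 * 2 ^ (2 + e))    ≡⟨ x∙yz≈y∙xz (suc b) 2 (2 ^ (2 + e)) ⟩
    2 * (suc b * 2 ^ (2 + e))    ≤⟨ *-monoʳ-≤ 2 (go e) ⟩
    2 * (2 + b) ^ (2 + e)        ≤⟨ *-monoˡ-≤ ((2 + b) ^ (2 + e)) (m≤m+n 2 b) ⟩
    (2 + b) * (2 + b) ^ (2 + e)  ∎

applyUpTo-cong : ∀ {A : Set} {f g : ℕ → A} → (∀ j → f j ≡ g j) → ∀ n → applyUpTo f n ≡ applyUpTo g n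
applyUpTo-cong f≗g zero    = refl
applyUpTo-cong f≗g (suc n) = cong₂ _∷_ (f≗g 0) (applyUpTo-cong (f≗g ∘ suc) n)

sum-applyUpTo-vanishing : ∀ (f : ℕ → ℕ) {n} L → (∀ j → n ≤ j → f j ≡ 0) → n ≤ L →
                          sum (applyUpTo f L) ≡ sum (applyUpTo f n)
sum-applyUpTo-vanishing f zero    f≡0 z≤n       = refl
sum-applyUpTo-vanishing f (suc L) f≡0 z≤n       =
  cong₂ _+_ (f≡0 0 z≤n) (sum-applyUpTo-vanishing (f ∘ suc) L (λ j _ → f≡0 (suc j) z≤n) z≤n)
sum-applyUpTo-vanishing f (suc L) f≡0 (s≤s n≤L) =
  cong (f 0 +_) (sum-applyUpTo-vanishing (f ∘ suc) L (λ j n≤j → f≡0 (suc j) (s≤s n≤j)) n≤L)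

module _ (d : ℕ) where

  cntSummand : ℕ → ℕ → ℕ → ℕ
  cntSummand k m j = if does (j * suc k ^ d ≤? m) then cnt d (m ∸ j * suc k ^ d) k else 0

  cnt-suc-sum : ∀ m k → cnt d m (suc k) ≡ sum (applyUpTo (cntSummand k m) (suc m))
  cnt-suc-sum zero    k = cong sum (map-upTo (cntSummand k zero) 1)
  cnt-suc-sum (suc m) k = cong sum (map-upTo (cntSummand k (suc m)) (suc (suc m)))

  private
    j≤j*[1+k]^d : ∀ j k → j ≤ j * suc k ^ d
    j≤j*[1+k]^d j k = m≤m*n j (suc k ^ d) {{m^n≢0 (suc k) d}}

  cntSummand-shift : ∀ {m k} → suc k ^ d ≤ m → ∀ j → cntSummand k m (suc j) ≡ cntSummand k (m ∸ suc k ^ d) j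
  cntSummand-shift {m} {k} a≤m j =
    cong₂ (λ b x → if b then x else 0) (does-⇔ fits (_ ≤? m) (_ ≤? m ∸ a))
          (cong (λ x → cnt d x k) (sym (∸-+-assoc m a (j * a))))
    where
    a = suc k ^ d
    fits : (a + j * a ≤ m) ⇔ (j * a ≤ m ∸ a)
    fits = mk⇔ (λ h → m+n≤o⇒m≤o∸n (j * a) (subst (_≤ m) (+-comm a (j * a)) h))
               (λ h → subst (a + j * a ≤_) (m+[n∸m]≡n a≤m) (+-monoʳ-≤ a h))

  cntSummand-vanish : ∀ k {m} j → m < j * suc k ^ d → cntSummand k m j ≡ 0
  cntSummand-vanish k {m} j m<j*a =
    cong (λ b → if b then cnt d (m ∸ j * suc k ^ d) k else 0) (dec-false (_ ≤? m) (<⇒≱ m<j*a))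

  cnt-suc-≥ : ∀ {m k} → suc k ^ d ≤ m → cnt d m (suc k) ≡ cnt d m k + cnt d (m ∸ suc k ^ d) (suc k)
  cnt-suc-≥ {m} {k} a≤m = begin
    cnt d m (suc k)                                            ≡⟨ cnt-suc-sum m k ⟩
    cnt d m k + sum (applyUpTo (cntSummand k m ∘ suc) m)             ≡⟨ cong (λ xs → cnt d m k + sum xs) (applyUpTo-cong (cntSummand-shift a≤m) m) ⟩
    cnt d m k + sum (applyUpTo (cntSummand k (m ∸ a)) m)             ≡⟨ cong (cnt d m k +_) (sum-applyUpTo-vanishing (cntSummand k (m ∸ a)) m beyond m∸a<m) ⟩
    cnt d m k + sum (applyUpTo (cntSummand k (m ∸ a)) (suc (m ∸ a))) ≡⟨ cong (cnt d m k +_) (cnt-suc-sum (m ∸ a) k) ⟨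
    cnt d m k + cnt d (m ∸ a) (suc k)                          ∎
    where
    open ≡-Reasoning
    a = suc k ^ d
    m∸a<m : m ∸ a < m
    m∸a<m = ∸-monoʳ-< (m^n>0 (suc k) d) a≤m
    beyond : ∀ j → suc (m ∸ a) ≤ j → cntSummand k (m ∸ a) j ≡ 0
    beyond j m∸a<j = cntSummand-vanish k j (<-≤-trans m∸a<j (j≤j*[1+k]^d j k))

  cnt-suc-< : ∀ {m k} → m < suc k ^ d → cnt d m (suc k) ≡ cnt d m k
  cnt-suc-< {m} {k} m<a = begin
    cnt d m (suc k)                                 ≡⟨ cnt-suc-sum m k ⟩
    cnt d m k + sum (applyUpTo (cntSummand k m ∘ suc) m)  ≡⟨ cong (cnt d m k +_) (sum-applyUpTo-vanishing (cntSummand k m ∘ suc) m beyond z≤n) ⟩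
    cnt d m k + 0                                   ≡⟨ +-identityʳ (cnt d m k) ⟩
    cnt d m k                                       ∎
    where
    open ≡-Reasoning
    beyond : ∀ j → 0 ≤ j → cntSummand k m (suc j) ≡ 0
    beyond j _ = cntSummand-vanish k (suc j) (<-≤-trans m<a (m≤m+n (suc k ^ d) (j * suc k ^ d)))

  cnt-zero : ∀ k → cnt d 0 k ≡ 1
  cnt-zero zero    = refl
  cnt-zero (suc k) = trans (cnt-suc-< (m^n>0 (suc k) d)) (cnt-zero k)

  cnt-one : ∀ m → cnt d m 1 ≡ 1
  cnt-one zero    = cnt-zero 1
  cnt-one (suc m) = begin
    cnt d (suc m) 1                 ≡⟨ cnt-suc-≥ (≤-trans (≤-reflexive (^-zeroˡ d)) (s≤s z≤n)) ⟩
    0 + cnt d (suc m ∸ 1 ^ d) 1     ≡⟨ cong (λ x → cnt d (suc m ∸ x) 1) (^-zeroˡ d) ⟩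
    cnt d m 1                       ≡⟨ cnt-one m ⟩
    1                               ∎
    where open ≡-Reasoning

  cnt≤cnt-suc : ∀ m k → cnt d m k ≤ cnt d m (suc k)
  cnt≤cnt-suc m k with suc k ^ d ≤? m
  ... | yes a≤m = ≤-trans (m≤m+n (cnt d m k) _) (≤-reflexive (sym (cnt-suc-≥ a≤m)))
  ... | no  a≰m = ≤-reflexive (sym (cnt-suc-< (≰⇒> a≰m)))

  cnt-monoʳ-≤ : ∀ m {k k′} → k ≤′ k′ → cnt d m k ≤ cnt d m k′
  cnt-monoʳ-≤ m ≤′-refl        = ≤-refl
  cnt-monoʳ-≤ m (≤′-step k≤k′) = ≤-trans (cnt-monoʳ-≤ m k≤k′) (cnt≤cnt-suc m _)

  pA-one : pA d 1 ≡ 1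
  pA-one = cnt-one 1

  2≤pA[2^d] : 1 ≤ d → 2 ≤ pA d (2 ^ d)
  2≤pA[2^d] 1≤d = begin
    2                           ≡⟨ cong₂ _+_ (cnt-one s) (cnt-zero 2) ⟨
    cnt d s 1 + cnt d 0 2       ≡⟨ cong (λ x → cnt d s 1 + cnt d x 2) (n∸n≡0 s) ⟨
    cnt d s 1 + cnt d (s ∸ s) 2 ≡⟨ cnt-suc-≥ ≤-refl ⟨
    cnt d s 2                   ≤⟨ cnt-monoʳ-≤ s (≤⇒≤′ (^-monoʳ-≤ 2 1≤d)) ⟩
    cnt d s s                   ∎
    where
    open ≤-Reasoning
    s = 2 ^ d

module _ {d : ℕ} (2≤d : 2 ≤ d) where

  private instance
    2^d≢0 : NonZero (2 ^ d)
    2^d≢0 = m^n≢0 2 d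

  -- c(m,b+1) ≤ 2^N − 2^(N−b) + 1 for N = ⌊m/2^d⌋, written without subtraction; the slack
  -- 2^(N−b) is what absorbs the new summand c(m − (b+2)^d, b+2) in the induction step.
  CntBound : ℕ → ℕ → Set
  CntBound b m = cnt d m (suc b) + 2 ^ (m /2^ d ∸ b) ≤ 2 ^ (m /2^ d) + 1

  CntBound⇒cnt≤2^[m/2^d] : ∀ {b m} → CntBound b m → cnt d m (suc b) ≤ 2 ^ (m /2^ d)
  CntBound⇒cnt≤2^[m/2^d] {b} {m} bound =
    +-cancelʳ-≤ 1 _ _ (≤-trans (+-monoʳ-≤ (cnt d m (suc b)) (m^n>0 2 (m /2^ d ∸ b))) bound)

  cntBound-one : ∀ m → CntBound 0 m
  cntBound-one m = ≤-reflexive (trans (cong (_+ 2 ^ (m /2^ d)) (cnt-one d m)) (+-comm 1 _))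

  cntBound-suc : ∀ {b} → (∀ m → CntBound b m) → ∀ m → CntBound (suc b) m
  cntBound-suc {b} bound = <-rec (CntBound (suc b)) step
    where
    a = (2 + b) ^ d
    step : ∀ m → (∀ {m′} → m′ < m → CntBound (suc b) m′) → CntBound (suc b) m
    step m rec with a ≤? m
    ... | no a≰m = begin
      cnt d m (2 + b) + 2 ^ (N ∸ suc b)  ≤⟨ +-mono-≤ (≤-reflexive (cnt-suc-< d (≰⇒> a≰m))) (^-monoʳ-≤ 2 (∸-monoʳ-≤ N (n≤1+n b))) ⟩
      cnt d m (suc b) + 2 ^ (N ∸ b)      ≤⟨ bound m ⟩
      2 ^ N + 1                          ∎
      where
      open ≤-Reasoning
      N = m /2^ d
    ... | yes a≤m = begin
      cnt d m (2 + b) + 2 ^ e                              ≡⟨ cong (_+ 2 ^ e) (cnt-suc-≥ d a≤m) ⟩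
      cnt d m (suc b) + cnt d (m ∸ a) (2 + b) + 2 ^ e      ≤⟨ +-monoˡ-≤ (2 ^ e) (+-monoʳ-≤ (cnt d m (suc b)) rest≤2^e) ⟩
      cnt d m (suc b) + 2 ^ e + 2 ^ e                      ≡⟨ +-assoc (cnt d m (suc b)) (2 ^ e) (2 ^ e) ⟩
      cnt d m (suc b) + (2 ^ e + 2 ^ e)                    ≡⟨ cong (λ x → cnt d m (suc b) + (2 ^ e + x)) (+-identityʳ (2 ^ e)) ⟨
      cnt d m (suc b) + 2 ^ suc e                          ≡⟨ cong (λ x → cnt d m (suc b) + 2 ^ x) (+-∸-assoc 1 1+b≤N) ⟨
      cnt d m (suc b) + 2 ^ (N ∸ b)                        ≤⟨ bound m ⟩
      2 ^ N + 1                                            ∎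
      where
      open ≤-Reasoning
      N = m /2^ d
      e = N ∸ suc b
      [1+b]*2^d≤m : suc b * 2 ^ d ≤ m
      [1+b]*2^d≤m = ≤-trans ([1+b]*2^d≤[2+b]^d 2≤d b) a≤m
      1+b≤N : suc b ≤ N
      1+b≤N = m*n≤o⇒m≤o/n (suc b) (2 ^ d) m [1+b]*2^d≤m
      [m∸a]/2^d≤e : (m ∸ a) /2^ d ≤ e
      [m∸a]/2^d≤e = begin
        (m ∸ a) / 2 ^ d                  ≤⟨ /-monoˡ-≤ (2 ^ d) (∸-monoʳ-≤ m ([1+b]*2^d≤[2+b]^d 2≤d b)) ⟩
        (m ∸ suc b * 2 ^ d) / 2 ^ d      ≡⟨ [m∸n*o]/o≡m/o∸n m (suc b) (2 ^ d) ⟩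
        e                                ∎
      rest≤2^e : cnt d (m ∸ a) (2 + b) ≤ 2 ^ e
      rest≤2^e = ≤-trans (CntBound⇒cnt≤2^[m/2^d] (rec (∸-monoʳ-< (m^n>0 (2 + b) d) a≤m)))
                         (^-monoʳ-≤ 2 [m∸a]/2^d≤e)

  cntBound : ∀ b m → CntBound b m
  cntBound zero    = cntBound-one
  cntBound (suc b) = cntBound-suc (cntBound b)

  pA≤2^[m/2^d] : ∀ m → pA d m ≤ 2 ^ (m /2^ d)
  pA≤2^[m/2^d] zero    = m^n>0 2 (0 /2^ d)
  pA≤2^[m/2^d] (suc m) = CntBound⇒cnt≤2^[m/2^d] {m} (cntBound m (suc m))

  pAList≤2^[sum/2^d] : ∀ μ → pAList d μ ≤ 2 ^ (sum μ /2^ d)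
  pAList≤2^[sum/2^d] []      = m^n>0 2 (0 /2^ d)
  pAList≤2^[sum/2^d] (x ∷ μ) = begin
    pA d x * pAList d μ                        ≤⟨ *-mono-≤ (pA≤2^[m/2^d] x) (pAList≤2^[sum/2^d] μ) ⟩
    2 ^ (x /2^ d) * 2 ^ (sum μ /2^ d)          ≡⟨ ^-distribˡ-+-* 2 (x /2^ d) (sum μ /2^ d) ⟨
    2 ^ (x /2^ d + sum μ /2^ d)                ≤⟨ ^-monoʳ-≤ 2 (/-superadditive x (sum μ) (2 ^ d)) ⟩
    2 ^ ((x + sum μ) /2^ d)                    ∎
    where open ≤-Reasoning

  partition-pAList≤2^[n/2^d] : ∀ {n μ} → IsAPartition d n μ → pAList d μ ≤ 2 ^ (n /2^ d)
  partition-pAList≤2^[n/2^d] {μ = μ} (_ , refl) = pAList≤2^[sum/2^d] μ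

  isMaximizer : ∀ {n λs} → IsAPartition d n λs → 2 ^ (n /2^ d) ≤ pAList d λs → IsMaximizer d n λs
  isMaximizer λs-part 2^[n/2^d]≤ = λs-part , λ μ μ-part → ≤-trans (partition-pAList≤2^[n/2^d] μ-part) 2^[n/2^d]≤

sum-replicate : ∀ n x → sum (replicate n x) ≡ n * x
sum-replicate zero    x = refl
sum-replicate (suc n) x = cong (x +_) (sum-replicate n x)

product-replicate : ∀ n x → product (replicate n x) ≡ x ^ n
product-replicate zero    x = refl
product-replicate (suc n) x = cong (x *_) (product-replicate n x)

module _ (d : ℕ) where

  pAList-++ : ∀ xs ys → pAList d (xs ++ ys) ≡ pAList d xs * pAList d ys
  pAList-++ xs ys = trans (cong product (map-++ (pA d) xs ys)) (product-++ (map (pA d) xs) (map (pA d) ys))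

  pAList-replicate : ∀ n x → pAList d (replicate n x) ≡ pA d x ^ n
  pAList-replicate n x = trans (cong product (map-replicate (pA d) n x)) (product-replicate n (pA d x))

  1∈A : InA d 1
  1∈A = 1 , ≤-refl , sym (^-zeroˡ d)

  IsAPartition-++ : ∀ {m n xs ys} → IsAPartition d m xs → IsAPartition d n ys → IsAPartition d (m + n) (xs ++ ys)
  IsAPartition-++ {xs = xs} (xs⊆A , refl) (ys⊆A , refl) = ++⁺ xs⊆A ys⊆A , sum-++ xs _

  IsAPartition-replicate : ∀ n {x} → InA d x → IsAPartition d (n * x) (replicate n x)
  IsAPartition-replicate n x∈A = replicate⁺ n x∈A , sum-replicate n _

  mainPartition-isPartition : ∀ n → IsAPartition d n (mainPartition d n)
  mainPartition-isPartition n =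
    subst (λ m → IsAPartition d m (mainPartition d n)) q*s+t*1≡n
          (IsAPartition-++ (IsAPartition-replicate q (2 , s≤s z≤n , refl)) (IsAPartition-replicate t 1∈A))
    where
    open ≡-Reasoning
    s = 2 ^ d
    q = n /2^ d
    t = n ∸ s * q
    q*s+t*1≡n : q * s + t * 1 ≡ n
    q*s+t*1≡n = begin
      q * s + t * 1  ≡⟨ cong₂ _+_ (*-comm q s) (*-identityʳ t) ⟩
      s * q + t      ≡⟨ m+[n∸m]≡n (subst (_≤ n) (*-comm q s) (m/n*n≤m n s {{m^n≢0 2 d}})) ⟩
      n              ∎

  2^[n/2^d]≤pAList-mainPartition : 1 ≤ d → ∀ n → 2 ^ (n /2^ d) ≤ pAList d (mainPartition d n)
  2^[n/2^d]≤pAList-mainPartition 1≤d n = begin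
    2 ^ q                                                ≤⟨ ^-monoˡ-≤ q (2≤pA[2^d] d 1≤d) ⟩
    pA d s ^ q                                           ≡⟨ *-identityʳ _ ⟨
    pA d s ^ q * 1                                       ≡⟨ cong (pA d s ^ q *_) (trans (cong (_^ t) (pA-one d)) (^-zeroˡ t)) ⟨
    pA d s ^ q * pA d 1 ^ t                              ≡⟨ cong₂ _*_ (pAList-replicate q s) (pAList-replicate t 1) ⟨
    pAList d (replicate q s) * pAList d (replicate t 1)  ≡⟨ pAList-++ (replicate q s) (replicate t 1) ⟨
    pAList d (mainPartition d n)                         ∎
    where
    open ≤-Reasoning
    s = 2 ^ d
    q = n /2^ d
    t = n ∸ s * q

m∸n∸o≡m∸o∸n : ∀ m n o → m ∸ n ∸ o ≡ m ∸ o ∸ n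
m∸n∸o≡m∸o∸n m n o = trans (∸-+-assoc m n o) (trans (cong (m ∸_) (+-comm n o)) (sym (∸-+-assoc m o n)))

ninePartition-isPartition : ∀ r n → 9 * r ≤ n → IsAPartition 2 n (ninePartition r n)
ninePartition-isPartition r n 9r≤n =
  subst (λ m → IsAPartition 2 m (ninePartition r n)) r*9+[q*4+t*1]≡n
        (IsAPartition-++ 2 (IsAPartition-replicate 2 r (3 , s≤s z≤n , refl))
          (IsAPartition-++ 2 (IsAPartition-replicate 2 q (2 , s≤s z≤n , refl)) (IsAPartition-replicate 2 t (1∈A 2))))
  where
  open ≡-Reasoning
  x = n ∸ 9 * r
  q = x /2^ 2
  t = n ∸ 4 * q ∸ 9 * r
  r*9+[q*4+t*1]≡n : r * 9 + (q * 4 + t * 1) ≡ n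
  r*9+[q*4+t*1]≡n = begin
    r * 9 + (q * 4 + t * 1)      ≡⟨ cong₂ (λ u v → u + (v + t * 1)) (*-comm r 9) (*-comm q 4) ⟩
    9 * r + (4 * q + t * 1)      ≡⟨ cong (λ v → 9 * r + (4 * q + v)) (trans (*-identityʳ t) (m∸n∸o≡m∸o∸n n (4 * q) (9 * r))) ⟩
    9 * r + (4 * q + (x ∸ 4 * q)) ≡⟨ cong (9 * r +_) (m+[n∸m]≡n (subst (_≤ x) (*-comm q 4) (m/n*n≤m x 4))) ⟩
    9 * r + x                    ≡⟨ m+[n∸m]≡n 9r≤n ⟩
    n                            ∎

n/4≤2r+[n∸9r]/4 : ∀ n r → r ≤ n % 4 → n / 4 ≤ 2 * r + (n ∸ 9 * r) / 4
n/4≤2r+[n∸9r]/4 n r r≤n%4 = begin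
  n / 4                              ≤⟨ m*n≤o⇒m≤o/n (n / 4) 4 (n ∸ r) (m+n≤o⇒m≤o∸n (n / 4 * 4) n/4*4+r≤n) ⟩
  (n ∸ r) / 4                        ≤⟨ m≤n+m∸n ((n ∸ r) / 4) (2 * r) ⟩
  2 * r + ((n ∸ r) / 4 ∸ 2 * r)      ≡⟨ cong (2 * r +_) ([m∸n*o]/o≡m/o∸n (n ∸ r) (2 * r) 4) ⟨
  2 * r + (n ∸ r ∸ 2 * r * 4) / 4    ≡⟨ cong (λ v → 2 * r + v / 4) (trans (∸-+-assoc n r (2 * r * 4)) (cong (n ∸_) (r+2r*4≡9r r))) ⟩
  2 * r + (n ∸ 9 * r) / 4            ∎
  where
  open ≤-Reasoning
  r+2r*4≡9r : ∀ r → r + 2 * r * 4 ≡ 9 * r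
  r+2r*4≡9r = solve-∀
  n/4*4+r≤n : n / 4 * 4 + r ≤ n
  n/4*4+r≤n = begin
    n / 4 * 4 + r      ≤⟨ +-monoʳ-≤ (n / 4 * 4) r≤n%4 ⟩
    n / 4 * 4 + n % 4  ≡⟨ +-comm (n / 4 * 4) (n % 4) ⟩
    n % 4 + n / 4 * 4  ≡⟨ m≡m%n+[m/n]*n n 4 ⟨
    n                  ∎

pA₂[9]≡4 : pA 2 9 ≡ 4
pA₂[9]≡4 = refl

pA₂[4]≡2 : pA 2 4 ≡ 2
pA₂[4]≡2 = refl

2^[n/4]≤pAList-ninePartition : ∀ r n → r ≤ n % 4 → 2 ^ (n /2^ 2) ≤ pAList 2 (ninePartition r n)
2^[n/4]≤pAList-ninePartition r n r≤n%4 = begin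
  2 ^ (n / 4)                                ≤⟨ ^-monoʳ-≤ 2 (n/4≤2r+[n∸9r]/4 n r r≤n%4) ⟩
  2 ^ (2 * r + q)                            ≡⟨ ^-distribˡ-+-* 2 (2 * r) q ⟩
  2 ^ (2 * r) * 2 ^ q                        ≡⟨ cong₂ _*_ (^-*-assoc 2 2 r) (*-identityʳ (2 ^ q)) ⟨
  4 ^ r * (2 ^ q * 1)                        ≡⟨ cong (λ v → 4 ^ r * (2 ^ q * v)) (trans (cong (_^ t) (pA-one 2)) (^-zeroˡ t)) ⟨
  4 ^ r * (2 ^ q * pA 2 1 ^ t)               ≡⟨ cong₂ (λ u v → u ^ r * (v ^ q * pA 2 1 ^ t)) pA₂[9]≡4 pA₂[4]≡2 ⟨
  pA 2 9 ^ r * (pA 2 4 ^ q * pA 2 1 ^ t)     ≡⟨ cong₂ _*_ (pAList-replicate 2 r 9) (cong₂ _*_ (pAList-replicate 2 q 4) (pAList-replicate 2 t 1)) ⟨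
  pAList 2 nines * (pAList 2 fours * pAList 2 ones) ≡⟨ cong (pAList 2 nines *_) (pAList-++ 2 fours ones) ⟨
  pAList 2 nines * pAList 2 (fours ++ ones)  ≡⟨ pAList-++ 2 nines (fours ++ ones) ⟨
  pAList 2 (ninePartition r n)               ∎
  where
  open ≤-Reasoning
  q = (n ∸ 9 * r) /2^ 2
  t = n ∸ 4 * q ∸ 9 * r
  nines = replicate r 9
  fours = replicate q 4
  ones  = replicate t 1

1≤n%4 : ∀ {n} → n % 4 ≡ 1 ⊎ n % 4 ≡ 2 ⊎ n % 4 ≡ 3 → 1 ≤ n % 4
1≤n%4 (inj₁ n%4≡1)        rewrite n%4≡1 = s≤s z≤n
1≤n%4 (inj₂ (inj₁ n%4≡2)) rewrite n%4≡2 = s≤s z≤n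
1≤n%4 (inj₂ (inj₂ n%4≡3)) rewrite n%4≡3 = s≤s z≤n

2≤n%4 : ∀ {n} → n % 4 ≡ 2 ⊎ n % 4 ≡ 3 → 2 ≤ n % 4
2≤n%4 (inj₁ n%4≡2) rewrite n%4≡2 = s≤s (s≤s z≤n)
2≤n%4 (inj₂ n%4≡3) rewrite n%4≡3 = s≤s (s≤s z≤n)

theorem5p3 : (d n : ℕ) → 2 ≤ d → 1 ≤ n →
    ((3 ≤ d → IsMaximizer d n (mainPartition d n))
    × (d ≡ 2 →
        IsMaximizer 2 n (mainPartition 2 n)
        × ((n % 4 ≡ 1 ⊎ n % 4 ≡ 2 ⊎ n % 4 ≡ 3) → 9 ≤ n → IsMaximizer 2 n (ninePartition 1 n))
        × ((n % 4 ≡ 2 ⊎ n % 4 ≡ 3) → 18 ≤ n → IsMaximizer 2 n (ninePartition 2 n))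
        × (n % 4 ≡ 3 → 27 ≤ n → IsMaximizer 2 n (ninePartition 3 n))))
    × Σ (List ℕ) (λ λs → IsAPartition d n λs
        × (pAList d λs ≡ 2 ^ (n /2^ d))
        × ((μ : List ℕ) → IsAPartition d n μ → pAList d μ ≤ 2 ^ (n /2^ d)))
theorem5p3 d n 2≤d _ =
  ( (λ _ → mainMax)
  , λ { refl → mainMax , nineMax 1 ∘ 1≤n%4 {n} , nineMax 2 ∘ 2≤n%4 {n} , nineMax 3 ∘ ≤-reflexive ∘ sym } )
  , mainPartition d n , mainPartition-isPartition d n
  , ≤-antisym (partition-pAList≤2^[n/2^d] 2≤d (mainPartition-isPartition d n)) main-lower
  , λ μ → partition-pAList≤2^[n/2^d] 2≤d
  where
  main-lower : 2 ^ (n /2^ d) ≤ pAList d (mainPartition d n)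
  main-lower = 2^[n/2^d]≤pAList-mainPartition d (≤-trans (s≤s z≤n) 2≤d) n
  mainMax : IsMaximizer d n (mainPartition d n)
  mainMax = isMaximizer 2≤d (mainPartition-isPartition d n) main-lower
  nineMax : ∀ r → r ≤ n % 4 → 9 * r ≤ n → IsMaximizer 2 n (ninePartition r n)
  nineMax r r≤n%4 9r≤n =
    isMaximizer ≤-refl (ninePartition-isPartition r n 9r≤n) (2^[n/4]≤pAList-ninePartition r n r≤n%4)
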